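{- Let $m\ge 1$ and let $\Lambda=\{\lambda_1,\lambda_2,\dots,\lambda_m\}$ be real numbers. Then there is a weighted graph $W$ with $2m$ vertices such that $\Lambda\subset\operatorname{spec}(L_W)$.
   Context: A weighted graph is a simple graph on vertices $v_1,\dots,v_n$ together with a real (possibly negative) weight on each edge; its adjacency matrix $A$ is the symmetric $n\times n$ matrix whose $(i,j)$ entry is the weight of edge $v_iv_j$ (and $0$ if there is no edge, including on the diagonal), its degree matrix $D$ is the diagonal matrix whose $(i,i)$ entry is the sum of the $i$th row of $A$, and its Laplacian is $L_W=D-A$. $\operatorname{spec}(L_W)$ denotes the multiset of eigenvalues of $L_W$. -}

module Defs where

open import Level using (Level; _⊔_) renaming (suc to lsuc)
open import Data.Nat using (ℕ; zero; suc)
open import Data.Fin using (Fin; zero; suc; _≟_)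
open import Data.Bool using (Bool; true; false; if_then_else_)
open import Data.Product using (∃; _×_; _,_)
open import Relation.Nullary using (¬_; does)
open import Relation.Binary.PropositionalEquality using (_≡_)
open import Relation.Binary.Structures using (IsTotalOrder)
open import Algebra.Bundles using (CommutativeRing)

-- An axiomatic model of the real numbers: a Dedekind-complete ordered field
-- (carrier with setoid equality _≈_). Every such structure is (classically)
-- isomorphic to ℝ, so quantifying over all of them is the same as speaking of ℝ.
record RealNumbers (c ℓ : Level) : Set (lsuc (c ⊔ ℓ)) where
  field
    commutativeRing : CommutativeRing c ℓ
  open CommutativeRing commutativeRing public
  field
    _≤_          : Carrier → Carrier → Set ℓ
    isTotalOrder : IsTotalOrder _≈_ _≤_
    0≉1          : ¬ (0# ≈ 1#)
    inverse      : ∀ x → ¬ (x ≈ 0#) → ∃ λ y → x * y ≈ 1#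
    +-monoˡ-≤    : ∀ {x y} z → x ≤ y → (x + z) ≤ (y + z)
    *-nonneg     : ∀ {x y} → 0# ≤ x → 0# ≤ y → 0# ≤ (x * y)
    lub          : (P : Carrier → Set (c ⊔ ℓ)) → ∃ P →
                   (∃ λ b → ∀ x → P x → x ≤ b) →
                   ∃ λ s → (∀ x → P x → x ≤ s) ×
                           (∀ b → (∀ x → P x → x ≤ b) → s ≤ b)

module _ {c ℓ : Level} (ℝ : RealNumbers c ℓ) where
  open RealNumbers ℝ hiding (zero)

  sumFin : (n : ℕ) → (Fin n → Carrier) → Carrier
  sumFin zero    f = 0#
  sumFin (suc n) f = f zero + sumFin n (λ i → f (suc i))

  record WeightedGraph (n : ℕ) : Set (c ⊔ ℓ) where
    field
      edge      : Fin n → Fin n → Bool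
      edge-sym  : ∀ i j → edge i j ≡ edge j i
      edge-irr  : ∀ i → edge i i ≡ false
      weight    : Fin n → Fin n → Carrier
      weight-sym : ∀ i j → weight i j ≈ weight j i

  module _ {n : ℕ} (W : WeightedGraph n) where
    open WeightedGraph W

    adjacency : Fin n → Fin n → Carrier
    adjacency i j = if edge i j then weight i j else 0#

    degree : Fin n → Carrier
    degree i = sumFin n (adjacency i)

    laplacian : Fin n → Fin n → Carrier
    laplacian i j = (if does (i ≟ j) then degree i else 0#) - adjacency i j

  IsEigenvalue : {n : ℕ} → (Fin n → Fin n → Carrier) → Carrier → Set (c ⊔ ℓ)
  IsEigenvalue {n} M λ′ =
    ∃ λ (v : Fin n → Carrier) → ¬ (∀ i → v i ≈ 0#) ×
      (∀ i → sumFin n (λ j → M i j * v j) ≈ λ′ * v i)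

{-# OPTIONS --safe #-}

-- Each label k is carried by the pair of vertices (0, k), (1, k) of Fin (2 * m),
-- joined by an edge of weight Λ k / 2 (1 + 1 is invertible in an ordered field).
-- The Laplacian of such a perfect matching π acts on π-antisymmetric vectors as
-- multiplication by twice the matched weight, so the vector that is 1 at (0, k),
-- -1 at (1, k) and 0 elsewhere is an eigenvector with eigenvalue Λ k.

module Submission where

open import Defs
open import Level using (Level)
open import Data.Nat using (ℕ; _≤_; _*_)
open import Data.Fin using (Fin)
open import Data.Product using (∃)

import Data.Nat as Nat
open import Data.Bool using (Bool; false; if_then_else_)
open import Data.Fin using (zero; suc; _≟_; combine; remQuot; opposite)
open import Data.Fin.Properties using (remQuot-combine; combine-remQuot; opposite-involutive; punchInᵢ≢i)
open import Data.Product using (_,_; proj₁; proj₂)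
open import Data.Sum using (inj₁; inj₂)
open import Data.Vec.Functional using (removeAt)
open import Function.Bundles using (mk⇔)
open import Relation.Binary.Structures using (IsTotalOrder)
open import Relation.Nullary using (¬_; does; yes; no)
open import Relation.Nullary.Decidable using (dec-true; dec-false; does-⇔)
open import Relation.Binary.PropositionalEquality as ≡ using (_≡_; _≢_)
import Algebra.Properties.Ring as RingProperties
import Algebra.Properties.Semiring.Sum as SemiringSum
import Relation.Binary.Reasoning.Setoid as SetoidReasoning

module Pairing (m : ℕ) where

  copy : Fin (2 * m) → Fin 2
  copy i = proj₁ (remQuot {2} m i)

  index : Fin (2 * m) → Fin m
  index i = proj₂ (remQuot {2} m i)

  copy-combine : ∀ (s : Fin 2) (k : Fin m) → copy (combine s k) ≡ s
  copy-combine s k = ≡.cong proj₁ (remQuot-combine {2} {m} s k)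

  index-combine : ∀ (s : Fin 2) (k : Fin m) → index (combine s k) ≡ k
  index-combine s k = ≡.cong proj₂ (remQuot-combine {2} {m} s k)

  swap : Fin (2 * m) → Fin (2 * m)
  swap i = combine (opposite (copy i)) (index i)

  copy-swap : ∀ i → copy (swap i) ≡ opposite (copy i)
  copy-swap i = copy-combine (opposite (copy i)) (index i)

  index-swap : ∀ i → index (swap i) ≡ index i
  index-swap i = index-combine (opposite (copy i)) (index i)

  swap-involutive : ∀ i → swap (swap i) ≡ i
  swap-involutive i = ≡.trans
    (≡.cong₂ combine (≡.trans (≡.cong opposite (copy-swap i)) (opposite-involutive (copy i))) (index-swap i))
    (combine-remQuot {2} m i)

  swap-fixpointFree : ∀ i → swap i ≢ i
  swap-fixpointFree i swapi≡i =
    opposite-fixpointFree (copy i) (≡.trans (≡.sym (copy-swap i)) (≡.cong copy swapi≡i))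
    where
    opposite-fixpointFree : (s : Fin 2) → opposite s ≢ s
    opposite-fixpointFree zero ()
    opposite-fixpointFree (suc zero) ()

module Spectral {c ℓ : Level} (ℝ : RealNumbers c ℓ) where
  open RealNumbers ℝ renaming (_≤_ to _≤ℝ_; _*_ to _·_) hiding (zero)
  open IsTotalOrder isTotalOrder using (antisym; total)
    renaming (trans to ≤-trans; reflexive to ≤-reflexive)
  open RingProperties ring using (-1*x≈-x; -‿involutive; -0#≈0#; -‿distribˡ-*; x[y-z]≈xy-xz)
  open SemiringSum semiring
    using (sum; sum-cong-≋; sum-replicate-zero; sum-remove; ∑-distrib-+; *-distribʳ-sum)
  open SetoidReasoning setoid

  0≤1 : 0# ≤ℝ 1#
  0≤1 with total 0# 1#
  ... | inj₁ 0≤1 = 0≤1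
  ... | inj₂ 1≤0 = ≤-trans (*-nonneg 0≤-1 0≤-1) (≤-reflexive -1·-1≈1)
    where
    0≤-1 : 0# ≤ℝ (- 1#)
    0≤-1 = ≤-trans (≤-reflexive (sym (-‿inverseʳ 1#)))
                   (≤-trans (+-monoˡ-≤ (- 1#) 1≤0) (≤-reflexive (+-identityˡ (- 1#))))
    -1·-1≈1 : - 1# · - 1# ≈ 1#
    -1·-1≈1 = trans (-1*x≈-x (- 1#)) (-‿involutive 1#)

  1+1≉0 : ¬ (1# + 1# ≈ 0#)
  1+1≉0 1+1≈0 = 0≉1 (antisym 0≤1 1≤0)
    where
    1≤0 : 1# ≤ℝ 0#
    1≤0 = ≤-trans (≤-reflexive (sym (+-identityˡ 1#)))
                  (≤-trans (+-monoˡ-≤ 1# 0≤1) (≤-reflexive 1+1≈0))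

  sumFin≡sum : ∀ n (f : Fin n → Carrier) → sumFin ℝ n f ≡ sum f
  sumFin≡sum Nat.zero    f = ≡.refl
  sumFin≡sum (Nat.suc n) f = ≡.cong (f zero +_) (sumFin≡sum n (λ j → f (suc j)))

  sumFin-zero : ∀ n {f : Fin n → Carrier} → (∀ j → f j ≈ 0#) → sumFin ℝ n f ≈ 0#
  sumFin-zero n {f} f≈0 = begin
    sumFin ℝ n f          ≡⟨ sumFin≡sum n f ⟩
    sum f                 ≈⟨ sum-cong-≋ f≈0 ⟩
    sum {n} (λ _ → 0#)    ≈⟨ sum-replicate-zero n ⟩
    0#                    ∎

  sumFin-single : ∀ {n} {f : Fin n → Carrier} a → (∀ j → j ≢ a → f j ≈ 0#) → sumFin ℝ n f ≈ f a
  sumFin-single {Nat.suc n} {f} a f≈0 = begin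
    sumFin ℝ (Nat.suc n) f           ≡⟨ sumFin≡sum (Nat.suc n) f ⟩
    sum f                            ≈⟨ sum-remove f ⟩
    f a + sum (removeAt f a)         ≡⟨ ≡.cong (f a +_) (sumFin≡sum n (removeAt f a)) ⟨
    f a + sumFin ℝ n (removeAt f a)  ≈⟨ +-congˡ (sumFin-zero n (λ j → f≈0 _ (punchInᵢ≢i a j))) ⟩
    f a + 0#                         ≈⟨ +-identityʳ (f a) ⟩
    f a                              ∎

  sumFin-cong : ∀ n {f g : Fin n → Carrier} → (∀ j → f j ≈ g j) → sumFin ℝ n f ≈ sumFin ℝ n g
  sumFin-cong Nat.zero    f≈g = refl
  sumFin-cong (Nat.suc n) f≈g = +-cong (f≈g zero) (sumFin-cong n (λ j → f≈g (suc j)))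

  sumFin-distrib-+ : ∀ n (f g : Fin n → Carrier) →
                     sumFin ℝ n (λ j → f j + g j) ≈ sumFin ℝ n f + sumFin ℝ n g
  sumFin-distrib-+ n f g = begin
    sumFin ℝ n (λ j → f j + g j)  ≡⟨ sumFin≡sum n _ ⟩
    sum (λ j → f j + g j)         ≈⟨ ∑-distrib-+ f g ⟩
    sum f + sum g                 ≡⟨ ≡.cong₂ _+_ (sumFin≡sum n f) (sumFin≡sum n g) ⟨
    sumFin ℝ n f + sumFin ℝ n g   ∎

  sumFin-distribʳ-· : ∀ n (f : Fin n → Carrier) x → sumFin ℝ n f · x ≈ sumFin ℝ n (λ j → f j · x)
  sumFin-distribʳ-· n f x = begin
    sumFin ℝ n f · x              ≡⟨ ≡.cong (_· x) (sumFin≡sum n f) ⟩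
    sum f · x                     ≈⟨ *-distribʳ-sum x f ⟩
    sum (λ j → f j · x)           ≡⟨ sumFin≡sum n _ ⟨
    sumFin ℝ n (λ j → f j · x)    ∎

  sumFin-diagonal : ∀ {n} (i : Fin n) x (v : Fin n → Carrier) →
                    sumFin ℝ n (λ j → (if does (i ≟ j) then x else 0#) · v j) ≈ x · v i
  sumFin-diagonal i x v = begin
    sumFin ℝ _ (λ j → δ j · v j)  ≈⟨ sumFin-single i off-diagonal ⟩
    δ i · v i                     ≡⟨ ≡.cong (λ b → (if b then x else 0#) · v i) (dec-true (i ≟ i) ≡.refl) ⟩
    x · v i                       ∎
    where
    δ : Fin _ → Carrier
    δ j = if does (i ≟ j) then x else 0#
    off-diagonal : ∀ j → j ≢ i → δ j · v j ≈ 0#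
    off-diagonal j j≢i = trans
      (reflexive (≡.cong (λ b → (if b then x else 0#) · v j) (dec-false (i ≟ j) (λ i≡j → j≢i (≡.sym i≡j)))))
      (zeroˡ (v j))

  laplacian-action : ∀ {n} (W : WeightedGraph ℝ n) (v : Fin n → Carrier) i →
                     sumFin ℝ n (λ j → laplacian ℝ W i j · v j)
                       ≈ sumFin ℝ n (λ j → adjacency ℝ W i j · (v i - v j))
  laplacian-action {n} W v i = begin
    sumFin ℝ n (λ j → L j · v j)
      ≈⟨ sumFin-cong n (λ j → trans (distribʳ (v j) (δ j) (- A j))
                                    (+-congˡ (sym (-‿distribˡ-* (A j) (v j))))) ⟩
    sumFin ℝ n (λ j → δ j · v j + - (A j · v j))
      ≈⟨ sumFin-distrib-+ n _ _ ⟩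
    sumFin ℝ n (λ j → δ j · v j) + sumFin ℝ n (λ j → - (A j · v j))
      ≈⟨ +-congʳ (sumFin-diagonal i (degree ℝ W i) v) ⟩
    degree ℝ W i · v i + sumFin ℝ n (λ j → - (A j · v j))
      ≈⟨ +-congʳ (sumFin-distribʳ-· n A (v i)) ⟩
    sumFin ℝ n (λ j → A j · v i) + sumFin ℝ n (λ j → - (A j · v j))
      ≈⟨ sumFin-distrib-+ n _ _ ⟨
    sumFin ℝ n (λ j → A j · v i + - (A j · v j))
      ≈⟨ sumFin-cong n (λ j → x[y-z]≈xy-xz (A j) (v i) (v j)) ⟨
    sumFin ℝ n (λ j → A j · (v i - v j))
      ∎
    where
    L A δ : Fin n → Carrier
    L = laplacian ℝ W i
    A = adjacency ℝ W i
    δ j = if does (i ≟ j) then degree ℝ W i else 0#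

  module Matching {n : ℕ} (π : Fin n → Fin n) (π-involutive : ∀ i → π (π i) ≡ i)
                  (π-fixpointFree : ∀ i → π i ≢ i)
                  (ω : Fin n → Fin n → Carrier) (ω-sym : ∀ i j → ω i j ≈ ω j i) where

    matched : Fin n → Fin n → Bool
    matched i j = does (j ≟ π i)

    matched-sym : ∀ i j → matched i j ≡ matched j i
    matched-sym i j = does-⇔ (mk⇔ (partner i j) (partner j i)) (j ≟ π i) (i ≟ π j)
      where
      partner : ∀ i j → j ≡ π i → i ≡ π j
      partner i j j≡πi = ≡.trans (≡.sym (π-involutive i)) (≡.cong π (≡.sym j≡πi))

    matched-irrefl : ∀ i → matched i i ≡ false
    matched-irrefl i = dec-false (i ≟ π i) (λ i≡πi → π-fixpointFree i (≡.sym i≡πi))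

    graph : WeightedGraph ℝ n
    graph = record
      { edge = matched ; edge-sym = matched-sym ; edge-irr = matched-irrefl
      ; weight = ω ; weight-sym = ω-sym }

    laplacian-action-antisymmetric : ∀ (v : Fin n → Carrier) → (∀ i → v (π i) ≈ - v i) → ∀ i →
      sumFin ℝ n (λ j → laplacian ℝ graph i j · v j) ≈ (ω i (π i) + ω i (π i)) · v i
    laplacian-action-antisymmetric v v-antisym i = begin
      sumFin ℝ n (λ j → laplacian ℝ graph i j · v j)  ≈⟨ laplacian-action graph v i ⟩
      sumFin ℝ n (λ j → A j · (v i - v j))            ≈⟨ sumFin-single (π i) unmatched ⟩
      A (π i) · (v i - v (π i))                       ≡⟨ ≡.cong (λ b → (if b then ω i (π i) else 0#) · (v i - v (π i)))
                                                                (dec-true (π i ≟ π i) ≡.refl) ⟩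
      ω i (π i) · (v i - v (π i))                     ≈⟨ *-congˡ (+-congˡ -v[πi]≈vi) ⟩
      ω i (π i) · (v i + v i)                         ≈⟨ distribˡ (ω i (π i)) (v i) (v i) ⟩
      ω i (π i) · v i + ω i (π i) · v i               ≈⟨ distribʳ (v i) (ω i (π i)) (ω i (π i)) ⟨
      (ω i (π i) + ω i (π i)) · v i                   ∎
      where
      A : Fin n → Carrier
      A = adjacency ℝ graph i
      -v[πi]≈vi : - v (π i) ≈ v i
      -v[πi]≈vi = trans (-‿cong (v-antisym i)) (-‿involutive (v i))
      unmatched : ∀ j → j ≢ π i → A j · (v i - v j) ≈ 0#
      unmatched j j≢πi = trans
        (reflexive (≡.cong (λ b → (if b then ω i j else 0#) · (v i - v j)) (dec-false (j ≟ π i) j≢πi)))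
        (zeroˡ (v i - v j))

  ½ : Carrier
  ½ = proj₁ (inverse (1# + 1#) 1+1≉0)

  2·½≈1 : (1# + 1#) · ½ ≈ 1#
  2·½≈1 = proj₂ (inverse (1# + 1#) 1+1≉0)

  x·½+x·½≈x : ∀ x → x · ½ + x · ½ ≈ x
  x·½+x·½≈x x = begin
    x · ½ + x · ½             ≈⟨ distribʳ ½ x x ⟨
    (x + x) · ½               ≈⟨ *-congʳ (+-cong (*-identityʳ x) (*-identityʳ x)) ⟨
    (x · 1# + x · 1#) · ½     ≈⟨ *-congʳ (distribˡ x 1# 1#) ⟨
    x · (1# + 1#) · ½         ≈⟨ *-assoc x (1# + 1#) ½ ⟩
    x · ((1# + 1#) · ½)       ≈⟨ *-congˡ 2·½≈1 ⟩
    x · 1#                    ≈⟨ *-identityʳ x ⟩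
    x                         ∎

  module LabelledPairs (m : ℕ) (Λ : Fin m → Carrier) where
    open Pairing m

    -- Λ k / 2 on the k-th pair, written via both endpoint labels so that it is symmetric.
    weight : Fin (2 * m) → Fin (2 * m) → Carrier
    weight i j = (Λ (index i) + Λ (index j)) · ½ · ½

    weight-sym : ∀ i j → weight i j ≈ weight j i
    weight-sym i j = *-congʳ (*-congʳ (+-comm (Λ (index i)) (Λ (index j))))

    open Matching swap swap-involutive swap-fixpointFree weight weight-sym public

    doubled-weight : ∀ i → weight i (swap i) + weight i (swap i) ≈ Λ (index i)
    doubled-weight i = begin
      weight i (swap i) + weight i (swap i)          ≈⟨ x·½+x·½≈x _ ⟩
      (Λ (index i) + Λ (index (swap i))) · ½         ≡⟨ ≡.cong (λ k → (Λ (index i) + Λ k) · ½) (index-swap i) ⟩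
      (Λ (index i) + Λ (index i)) · ½                ≈⟨ distribʳ ½ _ _ ⟩
      Λ (index i) · ½ + Λ (index i) · ½              ≈⟨ x·½+x·½≈x _ ⟩
      Λ (index i)                                    ∎

    sign : Fin 2 → Carrier
    sign zero       = 1#
    sign (suc zero) = - 1#

    sign-opposite : ∀ s → sign (opposite s) ≈ - sign s
    sign-opposite zero       = refl
    sign-opposite (suc zero) = sym (-‿involutive 1#)

    eigenvector : Fin m → Fin (2 * m) → Carrier
    eigenvector k j = if does (index j ≟ k) then sign (copy j) else 0#

    eigenvector-antisymmetric : ∀ k i → eigenvector k (swap i) ≈ - eigenvector k i
    eigenvector-antisymmetric k i rewrite index-swap i | copy-swap i with index i ≟ k
    ... | yes _ = sign-opposite (copy i)
    ... | no  _ = sym -0#≈0#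

    eigenvector-nonzero : ∀ k → ¬ (∀ j → eigenvector k j ≈ 0#)
    eigenvector-nonzero k eigenvector≈0 = 0≉1 (begin
      0#                             ≈⟨ eigenvector≈0 j ⟨
      eigenvector k j                ≡⟨ ≡.cong (λ b → if b then sign (copy j) else 0#)
                                               (dec-true (index j ≟ k) (index-combine zero k)) ⟩
      sign (copy j)                  ≡⟨ ≡.cong sign (copy-combine zero k) ⟩
      1#                             ∎)
      where
      j : Fin (2 * m)
      j = combine {2} zero k

    eigenvector-scaled : ∀ k i → (weight i (swap i) + weight i (swap i)) · eigenvector k i
                                   ≈ Λ k · eigenvector k i
    eigenvector-scaled k i with index i ≟ k
    ... | yes index≡k = *-congʳ (trans (doubled-weight i) (reflexive (≡.cong Λ index≡k)))
    ... | no  _       = trans (zeroʳ _) (sym (zeroʳ _))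

    eigenvalue : ∀ k → IsEigenvalue ℝ (laplacian ℝ graph) (Λ k)
    eigenvalue k = eigenvector k , eigenvector-nonzero k , λ i →
      trans (laplacian-action-antisymmetric (eigenvector k) (eigenvector-antisymmetric k) i)
            (eigenvector-scaled k i)

corollary5p2 : {c ℓ : Level} (ℝ : RealNumbers c ℓ) (m : ℕ) → 1 ≤ m →
               (Λ : Fin m → RealNumbers.Carrier ℝ) →
               ∃ λ (W : WeightedGraph ℝ (2 * m)) →
                 ∀ k → IsEigenvalue ℝ (laplacian ℝ W) (Λ k)
corollary5p2 ℝ m _ Λ = graph , eigenvalue
  where
  open Spectral ℝ
  open LabelledPairs m Λ
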